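{- Suppose $n=2^m-1$ for some integer $m\ge0$. Then $A_{n,0}(1)=1$, and $A_{n,k}(1)$ is an even integer for every $k\ge1$.
   Context: For a permutation $\sigma=b_1\ldots b_n$, $\mathrm{des}\,\sigma=\#\{i:b_i>b_{i+1}\}$ and $\mathrm{maj}\,\sigma=\sum_{b_i>b_{i+1}}i$. $\mathrm{Av}_n(321)$ is the set of permutations of $[n]$ with no $i<j<k$ such that $b_i>b_j>b_k$. $A_{n,k}(q)=\sum q^{\mathrm{maj}\,\sigma}$ over all $\sigma\in\mathrm{Av}_n(321)$ with $\mathrm{des}\,\sigma=k$; thus $A_{n,k}(1)$ is the number of $\sigma\in\mathrm{Av}_n(321)$ with exactly $k$ descents. -}

module Defs where

open import Data.Nat using (ℕ; zero; suc; _+_; _<_; _<ᵇ_)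
open import Data.Bool using (Bool; true; false; _∧_; _∨_; not; if_then_else_)
open import Data.List using (List; []; _∷_; map; concatMap; length; filter; upTo; any; all)
open import Relation.Nullary using (Dec)
open import Data.Bool.Properties using (T?)
open import Relation.Binary.PropositionalEquality using (_≡_)

-- A permutation σ = b₁ … bₙ of [n] = {1,…,n} is represented as the list
-- (b₁ ∷ … ∷ bₙ ∷ []).

insertions : ℕ → List ℕ → List (List ℕ)
insertions x []       = (x ∷ []) ∷ []
insertions x (y ∷ ys) = (x ∷ y ∷ ys) ∷ map (y ∷_) (insertions x ys)

perms : ℕ → List (List ℕ)
perms zero    = [] ∷ []
perms (suc n) = concatMap (insertions (suc n)) (perms n)

des : List ℕ → ℕ
des []           = 0
des (x ∷ [])     = 0
des (x ∷ y ∷ ys) = (if y <ᵇ x then 1 else 0) + des (y ∷ ys)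

-- does the list contain a decreasing subsequence of length k (starting
-- with an element smaller than the bound, when given)?
-- hasDec b k l : exists i₁<…<i_k with b > l[i₁] > … > l[i_k]
hasDec : ℕ → ℕ → List ℕ → Bool
hasDec b zero    l        = true
hasDec b (suc k) []       = false
hasDec b (suc k) (x ∷ xs) = ((x <ᵇ b) ∧ hasDec x k xs) ∨ hasDec b (suc k) xs

contains321 : List ℕ → Bool
contains321 []       = false
contains321 (x ∷ xs) = hasDec x 2 xs ∨ contains321 xs

avoids321 : List ℕ → Bool
avoids321 σ = not (contains321 σ)

Av321 : ℕ → List (List ℕ)
Av321 n = filter (λ σ → T? (avoids321 σ)) (perms n)

A1 : ℕ → ℕ → ℕ
A1 n k = length (filter (λ σ → Data.Nat._≟_ (des σ) k) (Av321 n))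

module Submission where

-- For a permutation σ let r(σ) be the length of its final increasing run, and consider
-- the binomial moments  M_n(i, D) = Σ_{σ ∈ Av_n(321), des σ = D} C(r(σ), i),  so that
-- A_{n,D}(1) = M_n(0, D).  Every avoider of length n+1 arises from exactly one avoider
-- of length n by inserting n+1 in front of or inside its final run, and the descents and
-- final runs of these insertions depend only on (des σ, r(σ)) (insertion-stats).
-- Summing binomial weights over them (Pascal's rule and the hockey-stick identity)
-- gives linear recurrences expressing M_{n+1} through M_n (moment-recurrence-0 and
-- moment-recurrence-S).  Hence M_n(i, 0) = C(n, i), and by induction modulo 2,
-- M_n(i, D+1) ≡ [i + 2(D+1) ≤ n+1] · C(n+1, i+D+1) (moment-parity).  For n + 1 = 2^m,
-- Lucas' theorem makes C(2^m, D+1) even for 0 < D+1 < 2^m, which proves the theorem.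

open import Defs
open import Data.Bool using (Bool; true; false; not; _∧_; _∨_; if_then_else_; T)
open import Data.Bool.Properties using (∨-zeroʳ; ∨-identityʳ; T?)
open import Data.Nat using (ℕ; zero; suc; _+_; _*_; _∸_; _^_; _≤_; _<_; _≥_; z≤n; s≤s; _<ᵇ_; _≡ᵇ_; _≤?_; _<?_; _≟_; pred; parity)
open import Data.Nat.Properties
open import Data.Parity.Base using (Parity; 0ℙ; 1ℙ) renaming (_+_ to _⊕_)
open import Data.Parity.Properties using (+-homo-+; *-homo-*; p+p≡0ℙ) renaming (+-assoc to ⊕-assoc; +-identityʳ to ⊕-identityʳ)
open import Data.List using (List; []; _∷_; map; length; filter; _++_; concatMap)
open import Data.List.Properties using (filter-++; filter-accept; filter-reject; filter-none; map-++; map-∘; map-cong-local; ∷-injectiveʳ; concatMap-pure)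
open import Data.List.Relation.Unary.All as All using (All; []; _∷_)
open import Data.List.Relation.Unary.All.Properties using (map⁺; concat⁺)
open import Data.Nat.ListAction using (sum)
open import Data.Nat.ListAction.Properties using (sum-++)
open import Function using (_∘_)
open import Algebra.Properties.CommutativeSemigroup +-commutativeSemigroup using () renaming (interchange to +-interchange)
open import Data.Product using (_×_; _,_; ∃-syntax)
open import Data.Sum using (_⊎_; inj₁; inj₂)
open import Data.Empty using (⊥-elim)
open import Relation.Nullary using (¬_; Dec; yes; no; does)
open import Relation.Nullary.Decidable using (dec-true; dec-false)
open import Relation.Binary.PropositionalEquality

binom : ℕ → ℕ → ℕ
binom _       zero    = 1
binom zero    (suc k) = 0
binom (suc n) (suc k) = binom n k + binom n (suc k)

binom-above : ∀ n k → n < k → binom n k ≡ 0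
binom-above zero    (suc k) _       = refl
binom-above (suc n) (suc k) (s≤s h) =
  cong₂ _+_ (binom-above n k h) (binom-above n (suc k) (m≤n⇒m≤1+n h))

binom-diag : ∀ n → binom n n ≡ 1
binom-diag zero    = refl
binom-diag (suc n) = cong₂ _+_ (binom-diag n) (binom-above n (suc n) ≤-refl)

binom-sym : ∀ m k → binom (m + k) k ≡ binom (m + k) m
binom-sym zero    k       = binom-diag k
binom-sym (suc m) zero    = sym (trans (cong (λ t → binom t (suc m)) (+-identityʳ (suc m))) (binom-diag (suc m)))
binom-sym (suc m) (suc k) =
  begin
    binom (m + suc k) k + binom (m + suc k) (suc k)
  ≡⟨ cong₂ _+_ (cong (λ t → binom t k) (+-suc m k)) (binom-sym m (suc k)) ⟩
    binom (suc m + k) k + binom (m + suc k) m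
  ≡⟨ cong (_+ binom (m + suc k) m) (binom-sym (suc m) k) ⟩
    binom (suc m + k) (suc m) + binom (m + suc k) m
  ≡⟨ +-comm (binom (suc m + k) (suc m)) _ ⟩
    binom (m + suc k) m + binom (suc m + k) (suc m)
  ≡⟨ cong (λ t → binom (m + suc k) m + binom t (suc m)) (sym (+-suc m k)) ⟩
    binom (m + suc k) m + binom (m + suc k) (suc m)
  ∎
  where open ≡-Reasoning

parity-even : ∀ a → parity a ≡ 0ℙ → ∃[ j ] a ≡ 2 * j
parity-even zero          _ = 0 , refl
parity-even (suc (suc a)) h with parity-even a h
... | j , refl = suc j , cong suc (sym (+-suc j (j + 0)))

central-binom-even : ∀ b → parity (binom (suc b + suc b) (suc b)) ≡ 0ℙ
central-binom-even b =
  begin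
    parity (binom (b + suc b) b + binom (b + suc b) (suc b))
  ≡⟨ cong (λ t → parity (binom (b + suc b) b + t)) (binom-sym b (suc b)) ⟩
    parity (binom (b + suc b) b + binom (b + suc b) b)
  ≡⟨ +-homo-+ (binom (b + suc b) b) _ ⟩
    parity (binom (b + suc b) b) ⊕ parity (binom (b + suc b) b)
  ≡⟨ p+p≡0ℙ (parity (binom (b + suc b) b)) ⟩
    0ℙ
  ∎
  where open ≡-Reasoning

pascal-twice : ∀ s k →
  parity (binom (suc (suc s)) (suc (suc k))) ≡ parity (binom s k) ⊕ parity (binom s (suc (suc k)))
pascal-twice s k =
  begin
    parity ((a + b) + (b + c))
  ≡⟨ +-homo-+ (a + b) (b + c) ⟩
    parity (a + b) ⊕ parity (b + c)
  ≡⟨ cong₂ _⊕_ (+-homo-+ a b) (+-homo-+ b c) ⟩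
    (pa ⊕ pb) ⊕ (pb ⊕ pc)
  ≡⟨ cancel pa pb pc ⟩
    pa ⊕ pc
  ∎
  where
  open ≡-Reasoning
  a b c : ℕ
  a = binom s k
  b = binom s (suc k)
  c = binom s (suc (suc k))
  pa pb pc : Parity
  pa = parity a
  pb = parity b
  pc = parity c
  cancel : ∀ p q r → (p ⊕ q) ⊕ (q ⊕ r) ≡ p ⊕ r
  cancel 0ℙ 0ℙ r  = refl
  cancel 0ℙ 1ℙ 0ℙ = refl
  cancel 0ℙ 1ℙ 1ℙ = refl
  cancel 1ℙ 0ℙ r  = refl
  cancel 1ℙ 1ℙ 0ℙ = refl
  cancel 1ℙ 1ℙ 1ℙ = refl

mutual
  binom-double-even : ∀ a j → parity (binom (a + a) (j + j)) ≡ parity (binom a j)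
  binom-double-even zero    zero    = refl
  binom-double-even zero    (suc j) = refl
  binom-double-even (suc a) zero    = refl
  binom-double-even (suc a) (suc j)
    rewrite +-suc a a | +-suc j j | pascal-twice (a + a) (j + j)
          | binom-double-even a j | sym (+-suc j j) | binom-double-even a (suc j)
    = sym (+-homo-+ (binom a j) (binom a (suc j)))

  binom-double-odd : ∀ a j → parity (binom (a + a) (suc (j + j))) ≡ 0ℙ
  binom-double-odd zero    j       = refl
  binom-double-odd (suc a) zero    rewrite +-suc a a = binom-double-odd a 0
  binom-double-odd (suc a) (suc j)
    rewrite +-suc a a | +-suc j j | pascal-twice (a + a) (suc (j + j))
          | binom-double-odd a j | sym (+-suc j j)
    = binom-double-odd a (suc j)

even-or-odd : ∀ k → ∃[ j ] (k ≡ j + j ⊎ k ≡ suc (j + j))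
even-or-odd zero = 0 , inj₁ refl
even-or-odd (suc k) with even-or-odd k
... | j , inj₁ refl = j , inj₂ refl
... | j , inj₂ refl = suc j , inj₁ (cong suc (sym (+-suc j j)))

halve-< : ∀ {j a} → j + j < a + a → j < a
halve-< {j} {a} h with j <? a
... | yes j<a = j<a
... | no  j≮a = ⊥-elim (<⇒≱ h (+-mono-≤ (≮⇒≥ j≮a) (≮⇒≥ j≮a)))

binom-pow2-even : ∀ m k → 0 < k → k < 2 ^ m → parity (binom (2 ^ m) k) ≡ 0ℙ
binom-pow2-even zero    (suc zero)    _ (s≤s ())
binom-pow2-even zero    (suc (suc k)) _ (s≤s ())
binom-pow2-even (suc m) k 0<k k<2^m with even-or-odd k
... | j , inj₂ refl rewrite +-identityʳ (2 ^ m) = binom-double-odd (2 ^ m) j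
... | zero  , inj₁ refl = ⊥-elim (<-irrefl refl 0<k)
... | suc j , inj₁ refl rewrite +-identityʳ (2 ^ m) | binom-double-even (2 ^ m) (suc j) =
  binom-pow2-even m (suc j) (s≤s z≤n) (halve-< k<2^m)

<ᵇ-true : ∀ {m n} → m < n → (m <ᵇ n) ≡ true
<ᵇ-true {m} {n} m<n with m <ᵇ n in e
... | true  = refl
... | false = ⊥-elim (subst T e (<⇒<ᵇ m<n))

<ᵇ-false : ∀ {m n} → n ≤ m → (m <ᵇ n) ≡ false
<ᵇ-false {m} {n} n≤m with m <ᵇ n in e
... | false = refl
... | true  = ⊥-elim (<⇒≱ (<ᵇ⇒< m n (subst T (sym e) _)) n≤m)

<ᵇ-true⁻¹ : ∀ {m n} → (m <ᵇ n) ≡ true → m < n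
<ᵇ-true⁻¹ {m} {n} e = <ᵇ⇒< m n (subst T (sym e) _)

<ᵇ-false⁻¹ : ∀ {m n} → (m <ᵇ n) ≡ false → n ≤ m
<ᵇ-false⁻¹ {m} {n} e = ≮⇒≥ (λ m<n → subst T e (<⇒<ᵇ m<n))

≡ᵇ-refl : ∀ n → (n ≡ᵇ n) ≡ true
≡ᵇ-refl zero    = refl
≡ᵇ-refl (suc n) = ≡ᵇ-refl n

≡ᵇ-false : ∀ {m n} → m ≢ n → (m ≡ᵇ n) ≡ false
≡ᵇ-false {m} {n} m≢n with m ≡ᵇ n in e
... | false = refl
... | true  = ⊥-elim (m≢n (≡ᵇ⇒≡ m n (subst T (sym e) _)))

-- Whether a list is weakly increasing, and the length of its final increasing run
-- (the longest increasing suffix); for a permutation both notions are strict.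
isIncreasing : List ℕ → Bool
isIncreasing []           = true
isIncreasing (y ∷ [])     = true
isIncreasing (y ∷ z ∷ zs) = not (z <ᵇ y) ∧ isIncreasing (z ∷ zs)

finalRun : List ℕ → ℕ
finalRun []       = 0
finalRun (y ∷ ys) = if isIncreasing (y ∷ ys) then suc (length ys) else finalRun ys

increasing-des : ∀ l → isIncreasing l ≡ true → des l ≡ 0
increasing-des []           _ = refl
increasing-des (y ∷ [])     _ = refl
increasing-des (y ∷ z ∷ zs) e with increasing-des (z ∷ zs) | z <ᵇ y
... | des-tail | false = des-tail e

nonIncreasing-des : ∀ l → isIncreasing l ≡ false → 0 < des l
nonIncreasing-des (y ∷ z ∷ zs) e with nonIncreasing-des (z ∷ zs) | z <ᵇ y
... | _        | true  = s≤s z≤n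
... | des-tail | false = des-tail e

finalRun-≤ : ∀ l → finalRun l ≤ length l
finalRun-≤ []       = z≤n
finalRun-≤ (y ∷ ys) with isIncreasing (y ∷ ys)
... | true  = ≤-refl
... | false = m≤n⇒m≤1+n (finalRun-≤ ys)

finalRun-< : ∀ l → isIncreasing l ≡ false → finalRun l < length l
finalRun-< (y ∷ ys) e rewrite e = s≤s (finalRun-≤ ys)

finalRun-full : ∀ l → (finalRun l ≡ᵇ length l) ≡ isIncreasing l
finalRun-full []       = refl
finalRun-full (y ∷ ys) with isIncreasing (y ∷ ys)
... | true  = ≡ᵇ-refl (length ys)
... | false = ≡ᵇ-false (<⇒≢ (s≤s (finalRun-≤ ys)))

finalRun-pos : ∀ y ys → ∃[ r ] finalRun (y ∷ ys) ≡ suc r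
finalRun-pos y []       = 0 , refl
finalRun-pos y (z ∷ zs) with isIncreasing (y ∷ z ∷ zs)
... | true  = suc (length zs) , refl
... | false = finalRun-pos z zs

Below : ℕ → List ℕ → Set
Below x σ = All (_< x) σ

-- Inserting a value x ≥ b anywhere does not create or destroy a decreasing
-- subsequence bounded by b, since x can never take part in one.
hasDec-insertions : ∀ x ys b k → b ≤ x → All (λ w → hasDec b k w ≡ hasDec b k ys) (insertions x ys)
hasDec-insertions x ys b zero b≤x = All.universal (λ _ → refl) (insertions x ys)
hasDec-insertions x [] b (suc k) b≤x = cong (λ t → (t ∧ hasDec x k []) ∨ false) (<ᵇ-false b≤x) ∷ []
hasDec-insertions x (y ∷ ys) b (suc k) b≤x =
  cong (λ t → (t ∧ hasDec x k (y ∷ ys)) ∨ hasDec b (suc k) (y ∷ ys)) (<ᵇ-false b≤x)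
    ∷ map⁺ (later (y <ᵇ b) refl)
  where
  later : ∀ t → (y <ᵇ b) ≡ t →
    All (λ w → ((t ∧ hasDec y k w) ∨ hasDec b (suc k) w) ≡ ((t ∧ hasDec y k ys) ∨ hasDec b (suc k) ys)) (insertions x ys)
  later false _ = hasDec-insertions x ys b (suc k) b≤x
  later true  e = All.zipWith (λ (p , q) → cong₂ _∨_ p q)
    (hasDec-insertions x ys y k (≤-trans (<⇒≤ (<ᵇ-true⁻¹ e)) b≤x) , hasDec-insertions x ys b (suc k) b≤x)

increasing-noneBelow : ∀ y z zs → isIncreasing (z ∷ zs) ≡ true → y ≤ z → hasDec y 1 zs ≡ false
increasing-noneBelow y z []       _ _   = refl
increasing-noneBelow y z (w ∷ ws) e y≤z with w <ᵇ z in w≮z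
... | false rewrite <ᵇ-false (≤-trans y≤z (<ᵇ-false⁻¹ w≮z)) =
  increasing-noneBelow y w ws e (≤-trans y≤z (<ᵇ-false⁻¹ w≮z))

max-starts-321 : ∀ x σ → Below x σ → hasDec x 2 σ ≡ not (isIncreasing σ)
max-starts-321 x []           _                 = refl
max-starts-321 x (y ∷ [])     (y<x ∷ _)         rewrite <ᵇ-true y<x = refl
max-starts-321 x (y ∷ z ∷ zs) (y<x ∷ z∷zs<x) rewrite <ᵇ-true y<x | max-starts-321 x (z ∷ zs) z∷zs<x
  with z <ᵇ y in z<y
... | true = refl
... | false with isIncreasing (z ∷ zs) in inc
...   | true  rewrite increasing-noneBelow y z zs inc (<ᵇ-false⁻¹ z<y) = refl
...   | false = ∨-zeroʳ _

avoiders : List (List ℕ) → List (List ℕ)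
avoiders = filter (λ σ → T? (avoids321 σ))

avoiders-keep : ∀ σ l → contains321 σ ≡ false → avoiders (σ ∷ l) ≡ σ ∷ avoiders l
avoiders-keep σ l e = filter-accept (λ σ → T? (avoids321 σ)) {σ} {l} (subst (λ b → T (not b)) (sym e) _)

avoiders-drop : ∀ σ l → contains321 σ ≡ true → avoiders (σ ∷ l) ≡ avoiders l
avoiders-drop σ l e = filter-reject (λ σ → T? (avoids321 σ)) {σ} {l} (subst (λ b → T (not b)) e)

avoiders-++ : ∀ l m → avoiders (l ++ m) ≡ avoiders l ++ avoiders m
avoiders-++ = filter-++ (λ σ → T? (avoids321 σ))

avoiders-none : ∀ l → All (λ w → contains321 w ≡ true) l → avoiders l ≡ []
avoiders-none l ps = filter-none (λ σ → T? (avoids321 σ)) (All.map (λ e → subst (λ b → T (not b)) e) ps)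

avoiders-prepend : ∀ y l → All (λ w → contains321 (y ∷ w) ≡ contains321 w) l →
  avoiders (map (y ∷_) l) ≡ map (y ∷_) (avoiders l)
avoiders-prepend y []      []       = refl
avoiders-prepend y (w ∷ l) (p ∷ ps) = by-cases (contains321 w) refl
  where
  rest : avoiders (map (y ∷_) l) ≡ map (y ∷_) (avoiders l)
  rest = avoiders-prepend y l ps
  by-cases : ∀ t → contains321 w ≡ t → avoiders (map (y ∷_) (w ∷ l)) ≡ map (y ∷_) (avoiders (w ∷ l))
  by-cases false e = trans (avoiders-keep (y ∷ w) _ (trans p e))
    (trans (cong ((y ∷ w) ∷_) rest) (cong (map (y ∷_)) (sym (avoiders-keep w l e))))
  by-cases true  e = trans (avoiders-drop (y ∷ w) _ (trans p e)) (trans rest (cong (map (y ∷_)) (sym (avoiders-drop w l e))))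

avoiders-All : ∀ {P : List ℕ → Set} {l} → All P l → All P (avoiders l)
avoiders-All {l = []}    []       = []
avoiders-All {l = σ ∷ l} (p ∷ ps) with contains321 σ
... | false = p ∷ avoiders-All ps
... | true  = avoiders-All ps

contains-insertions : ∀ x σ → Below x σ → contains321 σ ≡ true →
  All (λ w → contains321 w ≡ true) (insertions x σ)
contains-insertions x (y ∷ ys) (y<x ∷ ys<x) e =
  trans (cong (hasDec x 2 (y ∷ ys) ∨_) e) (∨-zeroʳ _) ∷ map⁺ (later (hasDec y 2 ys) refl)
  where
  later : ∀ t → hasDec y 2 ys ≡ t → All (λ w → (hasDec y 2 w ∨ contains321 w) ≡ true) (insertions x ys)
  later true  h = All.map (λ q → cong (_∨ _) (trans q h)) (hasDec-insertions x ys y 2 (<⇒≤ y<x))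
  later false h = All.map (λ {w} q → trans (cong (hasDec y 2 w ∨_) q) (∨-zeroʳ (hasDec y 2 w)))
    (contains-insertions x ys ys<x (trans (cong (_∨ contains321 ys) (sym h)) e))

front-contains : ∀ x σ → Below x σ → contains321 σ ≡ false → contains321 (x ∷ σ) ≡ not (isIncreasing σ)
front-contains x σ σ<x c =
  trans (cong (hasDec x 2 σ ∨_) c) (trans (∨-identityʳ _) (max-starts-321 x σ σ<x))

-- Behind the first entry y of an avoider, an inserted maximum cannot complete a 321 with y.
behind-first : ∀ x y ys → y < x → contains321 (y ∷ ys) ≡ false →
  avoiders (map (y ∷_) (insertions x ys)) ≡ map (y ∷_) (avoiders (insertions x ys))
behind-first x y ys y<x c = avoiders-prepend y (insertions x ys)
  (All.map (λ q → cong (_∨ _) (trans q (first-free c))) (hasDec-insertions x ys y 2 (<⇒≤ y<x)))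
  where
  first-free : ∀ {a b} → (a ∨ b) ≡ false → a ≡ false
  first-free {false} _ = refl

onlyIf : Bool → List ℕ → List (List ℕ)
onlyIf b l = if b then l ∷ [] else []

avoiding-insertions : ∀ x y ys → Below x (y ∷ ys) → contains321 (y ∷ ys) ≡ false →
  avoiders (insertions x (y ∷ ys)) ≡
    onlyIf (isIncreasing (y ∷ ys)) (x ∷ y ∷ ys) ++ map (y ∷_) (avoiders (insertions x ys))
avoiding-insertions x y ys (y<x ∷ ys<x) c = by-cases (isIncreasing (y ∷ ys)) refl
  where
  front : contains321 (x ∷ y ∷ ys) ≡ not (isIncreasing (y ∷ ys))
  front = front-contains x (y ∷ ys) (y<x ∷ ys<x) c
  by-cases : ∀ b → isIncreasing (y ∷ ys) ≡ b →
    avoiders (insertions x (y ∷ ys)) ≡ onlyIf b (x ∷ y ∷ ys) ++ map (y ∷_) (avoiders (insertions x ys))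
  by-cases true  inc = trans (avoiders-keep (x ∷ y ∷ ys) _ (trans front (cong not inc)))
                             (cong ((x ∷ y ∷ ys) ∷_) (behind-first x y ys y<x c))
  by-cases false inc = trans (avoiders-drop (x ∷ y ∷ ys) _ (trans front (cong not inc))) (behind-first x y ys y<x c)

stat : List ℕ → ℕ × ℕ
stat σ = des σ , finalRun σ

stat-increasing : ∀ y ys → isIncreasing (y ∷ ys) ≡ true → stat (y ∷ ys) ≡ (0 , length (y ∷ ys))
stat-increasing y ys e rewrite e = cong (_, suc (length ys)) (increasing-des (y ∷ ys) e)

runsDown : ℕ → ℕ → List (ℕ × ℕ)
runsDown a zero    = []
runsDown a (suc k) = (a , suc k) ∷ runsDown a k

-- Statistics of the 321-avoiding insertions of a new maximum into an avoider with
-- d descents and final run r: before the final run (d descents, at least one; run r),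
-- after its j-th entry for 0 < j < r (d+1 descents, run r-j), and at the very end
-- (d descents, run r+1).
insertionStatsTail : ℕ × ℕ → List (ℕ × ℕ)
insertionStatsTail (d , r) = runsDown (suc d) (pred r) ++ (d , suc r) ∷ []

insertionStats : ℕ × ℕ → List (ℕ × ℕ)
insertionStats (d , r) = (suc (pred d) , r) ∷ insertionStatsTail (d , r)

-- Effect on the statistics of prepending an entry: a new descent, or (when the list
-- had length N, so that a final run of length N means it was increasing) a longer run.
addDescent : ℕ × ℕ → ℕ × ℕ
addDescent (d , r) = suc d , r

extendFullRun : ℕ → ℕ × ℕ → ℕ × ℕ
extendFullRun N (d , r) = d , (if r ≡ᵇ N then suc N else r)

stat-prepend-descent : ∀ y z w → z < y → stat (y ∷ z ∷ w) ≡ addDescent (stat (z ∷ w))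
stat-prepend-descent y z w z<y rewrite <ᵇ-true z<y = refl

stat-prepend-ascent : ∀ y z w → y ≤ z → stat (y ∷ z ∷ w) ≡ extendFullRun (length (z ∷ w)) (stat (z ∷ w))
stat-prepend-ascent y z w y≤z rewrite <ᵇ-false y≤z | finalRun-full (z ∷ w) with isIncreasing (z ∷ w)
... | true  = refl
... | false = refl

stat-second : ∀ x y z w → y < x → z < x → stat (y ∷ x ∷ z ∷ w) ≡ addDescent (stat (z ∷ w))
stat-second x y z w y<x z<x rewrite <ᵇ-false (<⇒≤ y<x) | <ᵇ-true z<x = refl

addDescent-runsDown : ∀ a k → map addDescent (runsDown a k) ≡ runsDown (suc a) k
addDescent-runsDown a zero    = refl
addDescent-runsDown a (suc k) = cong ((suc a , suc k) ∷_) (addDescent-runsDown a k)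

addDescent-tail : ∀ p → map addDescent (insertionStatsTail p) ≡ insertionStatsTail (addDescent p)
addDescent-tail (d , r) =
  trans (map-++ addDescent (runsDown (suc d) (pred r)) ((d , suc r) ∷ []))
        (cong (_++ ((suc d , suc r) ∷ [])) (addDescent-runsDown (suc d) (pred r)))

addDescent-insertionStats : ∀ d r → 0 < d → map addDescent (insertionStats (d , r)) ≡ insertionStats (suc d , r)
addDescent-insertionStats (suc d) r _ = cong ((suc (suc d) , r) ∷_) (addDescent-tail (suc d , r))

extendFullRun-short : ∀ N d r → r < N → extendFullRun N (d , r) ≡ (d , r)
extendFullRun-short N d r r<N = cong (λ t → d , (if t then suc N else r)) (≡ᵇ-false (<⇒≢ r<N))

extendFullRun-runsDown : ∀ N a k → k < N → map (extendFullRun N) (runsDown a k) ≡ runsDown a k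
extendFullRun-runsDown N a zero    _   = refl
extendFullRun-runsDown N a (suc k) k<N =
  cong₂ _∷_ (extendFullRun-short N a (suc k) k<N) (extendFullRun-runsDown N a k (<-trans (n<1+n k) k<N))

extendFullRun-insertionStats : ∀ N d r → suc r < N → map (extendFullRun N) (insertionStats (d , r)) ≡ insertionStats (d , r)
extendFullRun-insertionStats N d r r+1<N =
  cong₂ _∷_ (extendFullRun-short N (suc (pred d)) r r<N)
    (trans (map-++ (extendFullRun N) (runsDown (suc d) (pred r)) ((d , suc r) ∷ []))
      (cong₂ _++_ (extendFullRun-runsDown N (suc d) (pred r) (≤-<-trans (pred[n]≤n {r}) r<N))
        (cong (_∷ []) (extendFullRun-short N d (suc r) r+1<N))))
  where
  r<N : r < N
  r<N = <-trans (n<1+n r) r+1<N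

extendFullRun-increasingTail : ∀ l →
  map (extendFullRun (suc (suc l))) (insertionStatsTail (0 , suc l)) ≡ runsDown 1 l ++ (0 , suc (suc (suc l))) ∷ []
extendFullRun-increasingTail l =
  trans (map-++ (extendFullRun (suc (suc l))) (runsDown 1 l) ((0 , suc (suc l)) ∷ []))
    (cong₂ _++_ (extendFullRun-runsDown (suc (suc l)) 1 l (m<n⇒m<1+n (n<1+n l)))
      (cong (λ t → (0 , (if t then suc (suc (suc l)) else suc (suc l))) ∷ []) (≡ᵇ-refl l)))

map-stat-prepend : ∀ y (f : ℕ × ℕ → ℕ × ℕ) L → All (λ v → stat (y ∷ v) ≡ f (stat v)) L →
  map stat (map (y ∷_) L) ≡ map f (map stat L)
map-stat-prepend y f L ps = trans (sym (map-∘ L)) (trans (map-cong-local ps) (map-∘ L))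

length-insertions : ∀ x ys → All (λ w → length w ≡ suc (length ys)) (insertions x ys)
length-insertions x []       = refl ∷ []
length-insertions x (y ∷ ys) = refl ∷ map⁺ (All.map (cong suc) (length-insertions x ys))

-- The inductive step of the insertion lemma, for the avoider σ = y ∷ τ, τ = z ∷ zs,
-- and a new maximum x: the avoiding insertions into σ are those into τ with y in
-- front, plus x ∷ σ when σ is increasing.
module InsertionStep (x y z : ℕ) (zs : List ℕ) (y<x : y < x) (τ<x : Below x (z ∷ zs))
                     (c : contains321 (y ∷ z ∷ zs) ≡ false) where
  τ σ : List ℕ
  τ = z ∷ zs
  σ = y ∷ τ

  N : ℕ
  N = length σ

  z<x : z < x
  z<x = All.head τ<x

  τ-avoids : contains321 τ ≡ false
  τ-avoids = second-free (hasDec y 2 τ) c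
    where
    second-free : ∀ a {b} → (a ∨ b) ≡ false → b ≡ false
    second-free false e = e

  later : List (List ℕ)
  later = map (z ∷_) (avoiders (insertions x zs))

  τ-split : avoiders (insertions x τ) ≡ onlyIf (isIncreasing τ) (x ∷ τ) ++ later
  τ-split = avoiding-insertions x z zs τ<x τ-avoids

  σ-split : avoiders (insertions x σ) ≡
    onlyIf (isIncreasing σ) (x ∷ σ) ++ map (y ∷_) (onlyIf (isIncreasing τ) (x ∷ τ) ++ later)
  σ-split = trans (avoiding-insertions x y τ (y<x ∷ τ<x) c) (cong (λ l → onlyIf (isIncreasing σ) (x ∷ σ) ++ map (y ∷_) l) τ-split)

  later-descent : z < y → map stat (map (y ∷_) later) ≡ map addDescent (map stat later)
  later-descent z<y = map-stat-prepend y addDescent later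
    (map⁺ (All.universal (λ w → stat-prepend-descent y z w z<y) _))

  later-ascent : y ≤ z → map stat (map (y ∷_) later) ≡ map (extendFullRun N) (map stat later)
  later-ascent y≤z = map-stat-prepend y (extendFullRun N) later
    (map⁺ (All.map (λ {w} len → trans (stat-prepend-ascent y z w y≤z) (cong (λ n → extendFullRun n (stat (z ∷ w))) len))
      (avoiders-All (All.map (cong suc) (length-insertions x zs)))))

  Hypothesis : Set
  Hypothesis = map stat (avoiders (insertions x τ)) ≡ insertionStats (stat τ)

  later-stats-increasing : isIncreasing τ ≡ true → Hypothesis → map stat later ≡ insertionStatsTail (stat τ)
  later-stats-increasing inc IH =
    ∷-injectiveʳ (trans (cong (map stat) (sym (trans τ-split (cong (λ b → onlyIf b (x ∷ τ) ++ later) inc)))) IH)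

  later-stats-otherwise : isIncreasing τ ≡ false → Hypothesis → map stat later ≡ insertionStats (stat τ)
  later-stats-otherwise inc IH =
    trans (cong (map stat) (sym (trans τ-split (cong (λ b → onlyIf b (x ∷ τ) ++ later) inc)))) IH

  σ-split-stats : ∀ {a b} → (z <ᵇ y) ≡ a → isIncreasing τ ≡ b → map stat (avoiders (insertions x σ)) ≡
    map stat (onlyIf (not a ∧ b) (x ∷ σ) ++ map (y ∷_) (onlyIf b (x ∷ τ) ++ later))
  σ-split-stats {a} {b} za inc = trans (cong (map stat) σ-split)
    (cong₂ (λ a b → map stat (onlyIf (not a ∧ b) (x ∷ σ) ++ map (y ∷_) (onlyIf b (x ∷ τ) ++ later))) za inc)

  open ≡-Reasoning

  descent-increasing : z < y → isIncreasing τ ≡ true → Hypothesis →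
    map stat (avoiders (insertions x σ)) ≡ insertionStats (stat σ)
  descent-increasing z<y inc IH = begin
      map stat (avoiders (insertions x σ))
    ≡⟨ σ-split-stats (<ᵇ-true z<y) inc ⟩
      stat (y ∷ x ∷ τ) ∷ map stat (map (y ∷_) later)
    ≡⟨ cong₂ _∷_ (stat-second x y z zs y<x z<x) (later-descent z<y) ⟩
      addDescent (stat τ) ∷ map addDescent (map stat later)
    ≡⟨ cong (λ l → addDescent (stat τ) ∷ map addDescent l) (later-stats-increasing inc IH) ⟩
      addDescent (stat τ) ∷ map addDescent (insertionStatsTail (stat τ))
    ≡⟨ cong (addDescent (stat τ) ∷_) (addDescent-tail (stat τ)) ⟩
      insertionStats (addDescent (stat τ))
    ≡⟨ cong insertionStats (stat-prepend-descent y z zs z<y) ⟨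
      insertionStats (stat σ)
    ∎

  descent-otherwise : z < y → isIncreasing τ ≡ false → Hypothesis →
    map stat (avoiders (insertions x σ)) ≡ insertionStats (stat σ)
  descent-otherwise z<y inc IH = begin
      map stat (avoiders (insertions x σ))
    ≡⟨ σ-split-stats (<ᵇ-true z<y) inc ⟩
      map stat (map (y ∷_) later)
    ≡⟨ later-descent z<y ⟩
      map addDescent (map stat later)
    ≡⟨ cong (map addDescent) (later-stats-otherwise inc IH) ⟩
      map addDescent (insertionStats (stat τ))
    ≡⟨ addDescent-insertionStats (des τ) (finalRun τ) (nonIncreasing-des τ inc) ⟩
      insertionStats (addDescent (stat τ))
    ≡⟨ cong insertionStats (stat-prepend-descent y z zs z<y) ⟨
      insertionStats (stat σ)
    ∎

  ascent-increasing : y ≤ z → isIncreasing τ ≡ true → Hypothesis →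
    map stat (avoiders (insertions x σ)) ≡ insertionStats (stat σ)
  ascent-increasing y≤z inc IH = begin
      map stat (avoiders (insertions x σ))
    ≡⟨ σ-split-stats (<ᵇ-false y≤z) inc ⟩
      stat (x ∷ σ) ∷ stat (y ∷ x ∷ τ) ∷ map stat (map (y ∷_) later)
    ≡⟨ cong₂ _∷_ (stat-prepend-descent x y τ y<x) (cong₂ _∷_ (stat-second x y z zs y<x z<x) (later-ascent y≤z)) ⟩
      addDescent (stat σ) ∷ addDescent (stat τ) ∷ map (extendFullRun N) (map stat later)
    ≡⟨ cong (λ l → addDescent (stat σ) ∷ addDescent (stat τ) ∷ map (extendFullRun N) l) (later-stats-increasing inc IH) ⟩
      addDescent (stat σ) ∷ addDescent (stat τ) ∷ map (extendFullRun N) (insertionStatsTail (stat τ))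
    ≡⟨ cong₂ (λ p q → addDescent p ∷ addDescent q ∷ map (extendFullRun N) (insertionStatsTail q))
             (stat-increasing y τ σ-increasing) (stat-increasing z zs inc) ⟩
      (1 , N) ∷ (1 , length τ) ∷ map (extendFullRun N) (insertionStatsTail (0 , length τ))
    ≡⟨ cong (λ l → (1 , N) ∷ (1 , length τ) ∷ l) (extendFullRun-increasingTail (length zs)) ⟩
      insertionStats (0 , N)
    ≡⟨ cong insertionStats (stat-increasing y τ σ-increasing) ⟨
      insertionStats (stat σ)
    ∎
    where
    σ-increasing : isIncreasing σ ≡ true
    σ-increasing = cong₂ (λ a b → not a ∧ b) (<ᵇ-false y≤z) inc

  ascent-otherwise : y ≤ z → isIncreasing τ ≡ false → Hypothesis →
    map stat (avoiders (insertions x σ)) ≡ insertionStats (stat σ)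
  ascent-otherwise y≤z inc IH = begin
      map stat (avoiders (insertions x σ))
    ≡⟨ σ-split-stats (<ᵇ-false y≤z) inc ⟩
      map stat (map (y ∷_) later)
    ≡⟨ later-ascent y≤z ⟩
      map (extendFullRun N) (map stat later)
    ≡⟨ cong (map (extendFullRun N)) (later-stats-otherwise inc IH) ⟩
      map (extendFullRun N) (insertionStats (stat τ))
    ≡⟨ extendFullRun-insertionStats N (des τ) (finalRun τ) (s≤s (finalRun-< τ inc)) ⟩
      insertionStats (stat τ)
    ≡⟨ cong insertionStats σ-stat ⟨
      insertionStats (stat σ)
    ∎
    where
    σ-stat : stat σ ≡ stat τ
    σ-stat = trans (stat-prepend-ascent y z zs y≤z) (extendFullRun-short (length τ) (des τ) (finalRun τ) (finalRun-< τ inc))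

  step : Hypothesis → map stat (avoiders (insertions x σ)) ≡ insertionStats (stat σ)
  step IH = cases (z <? y) (isIncreasing τ) refl
    where
    cases : Dec (z < y) → ∀ b → isIncreasing τ ≡ b → map stat (avoiders (insertions x σ)) ≡ insertionStats (stat σ)
    cases (yes z<y) true  inc = descent-increasing z<y inc IH
    cases (yes z<y) false inc = descent-otherwise z<y inc IH
    cases (no  z≮y) true  inc = ascent-increasing (≮⇒≥ z≮y) inc IH
    cases (no  z≮y) false inc = ascent-otherwise (≮⇒≥ z≮y) inc IH

insertion-stats : ∀ x y ys → Below x (y ∷ ys) → contains321 (y ∷ ys) ≡ false →
  map stat (avoiders (insertions x (y ∷ ys))) ≡ insertionStats (stat (y ∷ ys))
insertion-stats x y []       (y<x ∷ []) c =
  trans (cong (map stat) (avoiding-insertions x y [] (y<x ∷ []) c))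
        (cong₂ (λ p q → p ∷ q ∷ []) (stat-prepend-descent x y [] y<x) (stat-prepend-ascent y x [] (<⇒≤ y<x)))
insertion-stats x y (z ∷ zs) (y<x ∷ τ<x) c =
  step (insertion-stats x z zs τ<x τ-avoids)
  where open InsertionStep x y z zs y<x τ<x c

total : ℕ → (ℕ × ℕ → ℕ) → ℕ
total n f = sum (map (f ∘ stat) (Av321 n))

PermShape : ℕ → List ℕ → Set
PermShape n σ = Below (suc n) σ × length σ ≡ n

insertions-All : ∀ {P : ℕ → Set} x ys → All P ys → P x → All (All P) (insertions x ys)
insertions-All x []       []         px = (px ∷ []) ∷ []
insertions-All x (y ∷ ys) (py ∷ pys) px =
  (px ∷ py ∷ pys) ∷ map⁺ (All.map (py ∷_) (insertions-All x ys pys px))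

perms-shape : ∀ n → All (PermShape n) (perms n)
perms-shape zero    = ([] , refl) ∷ []
perms-shape (suc n) = concat⁺ (map⁺ (All.map insert-shape (perms-shape n)))
  where
  insert-shape : ∀ {σ} → PermShape n σ → All (PermShape (suc n)) (insertions (suc n) σ)
  insert-shape {σ} (σ<n+1 , len) = All.zipWith (λ (below , len′) → below , trans len′ (cong suc len))
    (insertions-All (suc n) σ (All.map m<n⇒m<1+n σ<n+1) ≤-refl , length-insertions (suc n) σ)

sum-avoiders-concatMap : ∀ (g : List ℕ → ℕ) (f : List ℕ → List (List ℕ)) l →
  sum (map g (avoiders (concatMap f l))) ≡ sum (map (λ σ → sum (map g (avoiders (f σ)))) l)
sum-avoiders-concatMap g f []      = refl
sum-avoiders-concatMap g f (σ ∷ l) =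
  begin
    sum (map g (avoiders (f σ ++ concatMap f l)))
  ≡⟨ cong (sum ∘ map g) (avoiders-++ (f σ) (concatMap f l)) ⟩
    sum (map g (avoiders (f σ) ++ avoiders (concatMap f l)))
  ≡⟨ cong sum (map-++ g (avoiders (f σ)) (avoiders (concatMap f l))) ⟩
    sum (map g (avoiders (f σ)) ++ map g (avoiders (concatMap f l)))
  ≡⟨ sum-++ (map g (avoiders (f σ))) (map g (avoiders (concatMap f l))) ⟩
    sum (map g (avoiders (f σ))) + sum (map g (avoiders (concatMap f l)))
  ≡⟨ cong (sum (map g (avoiders (f σ))) +_) (sum-avoiders-concatMap g f l) ⟩
    sum (map g (avoiders (f σ))) + sum (map (λ σ → sum (map g (avoiders (f σ)))) l)
  ∎
  where open ≡-Reasoning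

-- The total weight f of the insertions of a new maximum into an avoider σ with
-- statistics p; by the insertion lemma it only depends on p.
insertionsWeight : (ℕ × ℕ → ℕ) → ℕ × ℕ → ℕ
insertionsWeight f p = sum (map f (insertionStats p))

insertions-total : ∀ f x σ → σ ≢ [] → Below x σ →
  sum (map (f ∘ stat) (avoiders (insertions x σ))) ≡ sum (map (insertionsWeight f ∘ stat) (avoiders (σ ∷ [])))
insertions-total f x []       σ≢[] _   = ⊥-elim (σ≢[] refl)
insertions-total f x (y ∷ ys) _    σ<x = by-cases (contains321 (y ∷ ys)) refl
  where
  σ : List ℕ
  σ = y ∷ ys
  by-cases : ∀ t → contains321 σ ≡ t →
    sum (map (f ∘ stat) (avoiders (insertions x σ))) ≡ sum (map (insertionsWeight f ∘ stat) (avoiders (σ ∷ [])))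
  by-cases false c = begin
      sum (map (f ∘ stat) (avoiders (insertions x σ)))
    ≡⟨ cong sum (map-∘ (avoiders (insertions x σ))) ⟩
      sum (map f (map stat (avoiders (insertions x σ))))
    ≡⟨ cong (sum ∘ map f) (insertion-stats x y ys σ<x c) ⟩
      insertionsWeight f (stat σ)
    ≡⟨ +-identityʳ _ ⟨
      sum (map (insertionsWeight f ∘ stat) (σ ∷ []))
    ≡⟨ cong (sum ∘ map (insertionsWeight f ∘ stat)) (avoiders-keep σ [] c) ⟨
      sum (map (insertionsWeight f ∘ stat) (avoiders (σ ∷ [])))
    ∎
    where open ≡-Reasoning
  by-cases true c =
    trans (cong (sum ∘ map (f ∘ stat)) (avoiders-none _ (contains-insertions x σ σ<x c)))
          (sym (cong (sum ∘ map (insertionsWeight f ∘ stat)) (avoiders-drop σ [] c)))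

-- Every avoider of length n+1 arises from exactly one avoider of length n by
-- inserting n+1, so totals over Av_{n+1}(321) reduce to totals over Av_n(321).
total-suc : ∀ n f → 1 ≤ n → total (suc n) f ≡ total n (insertionsWeight f)
total-suc (suc m) f _ = begin
    sum (map (f ∘ stat) (avoiders (concatMap (insertions (suc n)) (perms n))))
  ≡⟨ sum-avoiders-concatMap (f ∘ stat) (insertions (suc n)) (perms n) ⟩
    sum (map (λ σ → sum (map (f ∘ stat) (avoiders (insertions (suc n) σ)))) (perms n))
  ≡⟨ cong sum (map-cong-local (All.map (λ (σ<n+1 , len) → insertions-total f (suc n) _ (nonempty len) σ<n+1) (perms-shape n))) ⟩
    sum (map (λ σ → sum (map (insertionsWeight f ∘ stat) (avoiders (σ ∷ [])))) (perms n))
  ≡⟨ sum-avoiders-concatMap (insertionsWeight f ∘ stat) (_∷ []) (perms n) ⟨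
    sum (map (insertionsWeight f ∘ stat) (avoiders (concatMap (_∷ []) (perms n))))
  ≡⟨ cong (sum ∘ map (insertionsWeight f ∘ stat) ∘ avoiders) (concatMap-pure (perms n)) ⟩
    total n (insertionsWeight f)
  ∎
  where
  open ≡-Reasoning
  n : ℕ
  n = suc m
  nonempty : ∀ {σ : List ℕ} → length σ ≡ suc m → σ ≢ []
  nonempty len refl = 0≢1+n len

sum-map-+ : ∀ {A : Set} (f g : A → ℕ) l → sum (map (λ a → f a + g a) l) ≡ sum (map f l) + sum (map g l)
sum-map-+ f g []      = refl
sum-map-+ f g (a ∷ l) rewrite sum-map-+ f g l = +-interchange (f a) (g a) (sum (map f l)) (sum (map g l))

sum-map-* : ∀ {A : Set} k (f : A → ℕ) l → sum (map (λ a → k * f a) l) ≡ k * sum (map f l)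
sum-map-* k f []      = sym (*-zeroʳ k)
sum-map-* k f (a ∷ l) rewrite sum-map-* k f l = sym (*-distribˡ-+ k (f a) (sum (map f l)))

sum-map-0 : ∀ {A : Set} (l : List A) → sum (map (λ _ → 0) l) ≡ 0
sum-map-0 []      = refl
sum-map-0 (a ∷ l) = sum-map-0 l

total-+ : ∀ n f g → total n (λ p → f p + g p) ≡ total n f + total n g
total-+ n f g = sum-map-+ (f ∘ stat) (g ∘ stat) (Av321 n)

total-* : ∀ n k f → total n (λ p → k * f p) ≡ k * total n f
total-* n k f = sum-map-* k (f ∘ stat) (Av321 n)

total-0 : ∀ n → total n (λ _ → 0) ≡ 0
total-0 n = sum-map-0 (Av321 n)

-- Permutations of a nonempty set have a nonempty final run, so totals only depend
-- on the weights of statistics (d , r) with r ≥ 1.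
total-cong : ∀ n f g → 1 ≤ n → (∀ d r → f (d , suc r) ≡ g (d , suc r)) → total n f ≡ total n g
total-cong (suc m) f g _ f≗g =
  cong sum (map-cong-local (All.map agree (avoiders-All {l = perms (suc m)} (perms-shape (suc m)))))
  where
  agree : ∀ {σ} → PermShape (suc m) σ → f (stat σ) ≡ g (stat σ)
  agree {y ∷ ys} _ with finalRun-pos y ys
  ... | r , run≡1+r rewrite run≡1+r = f≗g (des (y ∷ ys)) r

binomPred : ℕ → ℕ → ℕ
binomPred r zero    = 0
binomPred r (suc i) = binom r i

pascal : ∀ r i → binom (suc r) i ≡ binom r i + binomPred r i
pascal r zero    = refl
pascal r (suc i) = +-comm (binom r i) (binom r (suc i))

binomSum : ℕ → ℕ → ℕ
binomSum zero    i = 0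
binomSum (suc k) i = binom (suc k) i + binomSum k i

ifZero : ℕ → ℕ → ℕ
ifZero zero    x = x
ifZero (suc _) x = 0

ifZero-0 : ∀ i → ifZero i 0 ≡ 0
ifZero-0 zero    = refl
ifZero-0 (suc i) = refl

-- The hockey-stick identity Σ_{s=0}^{k} C(s, i) = C(k+1, i+1), with C(0, i) = [i = 0].
hockey-stick : ∀ k i → binomSum k i + ifZero i 1 ≡ binom (suc k) (suc i)
hockey-stick zero    zero    = refl
hockey-stick zero    (suc i) = refl
hockey-stick (suc k) i =
  trans (+-assoc (binom (suc k) i) (binomSum k i) (ifZero i 1)) (cong (binom (suc k) i +_) (hockey-stick k i))

momentWeight : ℕ → ℕ → ℕ × ℕ → ℕ
momentWeight i D (d , r) = if d ≡ᵇ D then binom r i else 0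

momentWeightPred : ℕ → ℕ → ℕ × ℕ → ℕ
momentWeightPred zero    D p = 0
momentWeightPred (suc i) D p = momentWeight i D p

momentWeight-miss : ∀ i {D d} r → d ≢ D → momentWeight i D (d , r) ≡ 0
momentWeight-miss i r d≢D = cong (λ t → if t then binom r i else 0) (≡ᵇ-false d≢D)

momentWeightPred-miss : ∀ i {D d} r → d ≢ D → momentWeightPred i D (d , r) ≡ 0
momentWeightPred-miss zero    r d≢D = refl
momentWeightPred-miss (suc i) r d≢D = momentWeight-miss i r d≢D

momentWeight-hit : ∀ i D r → momentWeight i D (D , r) ≡ binom r i
momentWeight-hit i D r = cong (λ t → if t then binom r i else 0) (≡ᵇ-refl D)

momentWeightPred-hit : ∀ i D r → momentWeightPred i D (D , r) ≡ binomPred r i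
momentWeightPred-hit zero    D r = refl
momentWeightPred-hit (suc i) D r = momentWeight-hit i D r

sum-runsDown-hit : ∀ i D k → sum (map (momentWeight i D) (runsDown D k)) ≡ binomSum k i
sum-runsDown-hit i D zero    = refl
sum-runsDown-hit i D (suc k) = cong₂ _+_ (momentWeight-hit i D (suc k)) (sum-runsDown-hit i D k)

sum-runsDown-miss : ∀ i {D a} k → a ≢ D → sum (map (momentWeight i D) (runsDown a k)) ≡ 0
sum-runsDown-miss i zero    a≢D = refl
sum-runsDown-miss i (suc k) a≢D = cong₂ _+_ (momentWeight-miss i (suc k) a≢D) (sum-runsDown-miss i k a≢D)

insertionsWeight-expand : ∀ f d r →
  insertionsWeight f (d , r) ≡ f (suc (pred d) , r) + (sum (map f (runsDown (suc d) (pred r))) + f (d , suc r))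
insertionsWeight-expand f d r = cong (f (suc (pred d) , r) +_)
  (trans (cong sum (map-++ f (runsDown (suc d) (pred r)) ((d , suc r) ∷ [])))
  (trans (sum-++ (map f (runsDown (suc d) (pred r))) (f (d , suc r) ∷ []))
         (cong (sum (map f (runsDown (suc d) (pred r))) +_) (+-identityʳ (f (d , suc r))))))

-- Pointwise form of the recurrence for avoiders without descents: the only avoiding
-- insertion with no descent is the one at the very end, which lengthens the run.
weight-recurrence-0 : ∀ i d r →
  insertionsWeight (momentWeight i 0) (d , suc r) ≡ momentWeight i 0 (d , suc r) + momentWeightPred i 0 (d , suc r)
weight-recurrence-0 i d r =
  trans (insertionsWeight-expand (momentWeight i 0) d (suc r))
        (trans (cong (_+ momentWeight i 0 (d , suc (suc r))) (sum-runsDown-miss i r λ ())) (last-insertion d))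
  where
  last-insertion : ∀ d → momentWeight i 0 (d , suc (suc r)) ≡ momentWeight i 0 (d , suc r) + momentWeightPred i 0 (d , suc r)
  last-insertion zero    = trans (pascal (suc r) i) (cong (binom (suc r) i +_) (sym (momentWeightPred-hit i 0 (suc r))))
  last-insertion (suc d) = sym (momentWeightPred-miss i (suc r) λ ())

ifZero-momentWeight-hit : ∀ i D r → ifZero D (momentWeight i 0 (D , r)) ≡ ifZero D (binom r i)
ifZero-momentWeight-hit i zero    r = refl
ifZero-momentWeight-hit i (suc D) r = refl

ifZero-momentWeight-miss : ∀ i {D d} r → d ≢ D → ifZero D (momentWeight i 0 (d , r)) ≡ 0
ifZero-momentWeight-miss i {zero}  r d≢D = momentWeight-miss i r d≢D
ifZero-momentWeight-miss i {suc D} r d≢D = refl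

first-insertion-same : ∀ i D r → momentWeight i (suc D) (suc (pred D) , r) ≡ ifZero D (binom r i)
first-insertion-same i zero    r = refl
first-insertion-same i (suc D) r = momentWeight-miss i r (n≢1+n (suc D))
  where
  n≢1+n : ∀ n → n ≢ suc n
  n≢1+n n = <⇒≢ (n<1+n n)

-- Writing s for the final run, an avoider
-- with D descents contributes through its middle insertions (D+1 descents, runs
-- 1, …, s-1) and, if D = 0, its first insertion; one with D+1 descents through its
-- first and last insertions; all others contribute nothing.
RecurrenceS : ℕ → ℕ → ℕ → ℕ → Set
RecurrenceS i D d s =
  insertionsWeight (momentWeight i (suc D)) (d , s) + ifZero i (momentWeight 0 D (d , s)) ≡
  2 * momentWeight i (suc D) (d , s) + momentWeightPred i (suc D) (d , s)
    + ifZero D (momentWeight i 0 (d , s)) + momentWeight (suc i) D (d , s)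

recurrenceS-same : ∀ i D r → RecurrenceS i D D (suc r)
recurrenceS-same i D r = begin
    insertionsWeight (momentWeight i (suc D)) (D , s) + ifZero i (momentWeight 0 D (D , s))
  ≡⟨ cong₂ _+_ (insertionsWeight-expand (momentWeight i (suc D)) D s) (cong (ifZero i) (momentWeight-hit 0 D s)) ⟩
    momentWeight i (suc D) (suc (pred D) , s)
      + (sum (map (momentWeight i (suc D)) (runsDown (suc D) r)) + momentWeight i (suc D) (D , suc s)) + ifZero i 1
  ≡⟨ cong (_+ ifZero i 1) (cong₂ _+_ (first-insertion-same i D s)
       (cong₂ _+_ (sum-runsDown-hit i (suc D) r) (momentWeight-miss i (suc s) (<⇒≢ (n<1+n D))))) ⟩
    ifZero D (binom s i) + (binomSum r i + 0) + ifZero i 1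
  ≡⟨ cong (λ t → ifZero D (binom s i) + t + ifZero i 1) (+-identityʳ (binomSum r i)) ⟩
    ifZero D (binom s i) + binomSum r i + ifZero i 1
  ≡⟨ +-assoc (ifZero D (binom s i)) (binomSum r i) (ifZero i 1) ⟩
    ifZero D (binom s i) + (binomSum r i + ifZero i 1)
  ≡⟨ cong (ifZero D (binom s i) +_) (hockey-stick r i) ⟩
    ifZero D (binom s i) + binom s (suc i)
  ≡⟨ cong₂ _+_ (cong₂ (λ a b → 2 * a + b + ifZero D (binom s i)) (momentWeight-miss i s (<⇒≢ (n<1+n D)))
                                                                  (momentWeightPred-miss i s (<⇒≢ (n<1+n D))))
               (momentWeight-hit (suc i) D s) ⟨
    2 * momentWeight i (suc D) (D , s) + momentWeightPred i (suc D) (D , s)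
      + ifZero D (binom s i) + momentWeight (suc i) D (D , s)
  ≡⟨ cong (λ t → 2 * momentWeight i (suc D) (D , s) + momentWeightPred i (suc D) (D , s) + t + momentWeight (suc i) D (D , s))
          (ifZero-momentWeight-hit i D s) ⟨
    2 * momentWeight i (suc D) (D , s) + momentWeightPred i (suc D) (D , s)
      + ifZero D (momentWeight i 0 (D , s)) + momentWeight (suc i) D (D , s)
  ∎
  where
  open ≡-Reasoning
  s : ℕ
  s = suc r

recurrenceS-above : ∀ i D r → RecurrenceS i D (suc D) (suc r)
recurrenceS-above i D r = begin
    insertionsWeight (momentWeight i (suc D)) (suc D , s) + ifZero i (momentWeight 0 D (suc D , s))
  ≡⟨ cong₂ _+_ (insertionsWeight-expand (momentWeight i (suc D)) (suc D) s)
               (trans (cong (ifZero i) (momentWeight-miss 0 s D+1≢D)) (ifZero-0 i)) ⟩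
    momentWeight i (suc D) (suc D , s)
      + (sum (map (momentWeight i (suc D)) (runsDown (suc (suc D)) r)) + momentWeight i (suc D) (suc D , suc s)) + 0
  ≡⟨ cong (_+ 0) (cong₂ _+_ (momentWeight-hit i (suc D) s)
       (cong₂ _+_ (sum-runsDown-miss i r (D+1≢D ∘ suc-injective)) (momentWeight-hit i (suc D) (suc s)))) ⟩
    binom s i + binom (suc s) i + 0
  ≡⟨ cong (λ t → binom s i + t + 0) (pascal s i) ⟩
    binom s i + (binom s i + binomPred s i) + 0
  ≡⟨ cong (_+ 0) (+-assoc (binom s i) (binom s i) (binomPred s i)) ⟨
    binom s i + binom s i + binomPred s i + 0
  ≡⟨ cong (λ t → t + binomPred s i + 0) (cong (binom s i +_) (+-identityʳ (binom s i))) ⟨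
    2 * binom s i + binomPred s i + 0
  ≡⟨ +-identityʳ _ ⟨
    2 * binom s i + binomPred s i + 0 + 0
  ≡⟨ cong₂ _+_ (cong₂ _+_ (cong₂ (λ a b → 2 * a + b) (momentWeight-hit i (suc D) s) (momentWeightPred-hit i (suc D) s))
                          (ifZero-momentWeight-miss i s D+1≢D))
               (momentWeight-miss (suc i) s D+1≢D) ⟨
    2 * momentWeight i (suc D) (suc D , s) + momentWeightPred i (suc D) (suc D , s)
      + ifZero D (momentWeight i 0 (suc D , s)) + momentWeight (suc i) D (suc D , s)
  ∎
  where
  open ≡-Reasoning
  s : ℕ
  s = suc r
  D+1≢D : suc D ≢ D
  D+1≢D = ≢-sym (<⇒≢ (n<1+n D))

recurrenceS-other : ∀ i D d r → d ≢ D → d ≢ suc D → RecurrenceS i D d (suc r)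
recurrenceS-other i D d r d≢D d≢D+1 =
  trans (cong₂ _+_ (trans (insertionsWeight-expand (momentWeight i (suc D)) d s)
                     (cong₂ _+_ (momentWeight-miss i s (first≢ d d≢D d≢D+1))
                       (cong₂ _+_ (sum-runsDown-miss i r (d≢D ∘ suc-injective)) (momentWeight-miss i (suc s) d≢D+1))))
                   (trans (cong (ifZero i) (momentWeight-miss 0 s d≢D)) (ifZero-0 i)))
        (sym (cong₂ _+_ (cong₂ _+_ (cong₂ (λ a b → 2 * a + b) (momentWeight-miss i s d≢D+1) (momentWeightPred-miss i s d≢D+1))
                                   (ifZero-momentWeight-miss i s d≢D))
                        (momentWeight-miss (suc i) s d≢D)))
  where
  s : ℕ
  s = suc r
  -- The first insertion has max(d, 1) descents, which is D+1 only if d ∈ {D, D+1}.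
  first≢ : ∀ d → d ≢ D → d ≢ suc D → suc (pred d) ≢ suc D
  first≢ zero    d≢D _      e = d≢D (suc-injective e)
  first≢ (suc d) _   d≢D+1 e = d≢D+1 e

recurrenceS : ∀ i D d r → RecurrenceS i D d (suc r)
recurrenceS i D d r with d ≟ D | d ≟ suc D
... | yes refl | _        = recurrenceS-same i D r
... | no  _    | yes refl = recurrenceS-above i D r
... | no  d≢D  | no d≢D+1 = recurrenceS-other i D d r d≢D d≢D+1

moment : ℕ → ℕ → ℕ → ℕ
moment n i D = total n (momentWeight i D)

momentPred : ℕ → ℕ → ℕ → ℕ
momentPred n zero    D = 0
momentPred n (suc i) D = moment n i D

total-momentWeightPred : ∀ n i D → total n (momentWeightPred i D) ≡ momentPred n i D
total-momentWeightPred n zero    D = total-0 n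
total-momentWeightPred n (suc i) D = refl

total-ifZero : ∀ n i f → total n (λ p → ifZero i (f p)) ≡ ifZero i (total n f)
total-ifZero n zero    f = refl
total-ifZero n (suc i) f = total-0 n

A1≡moment : ∀ n k → A1 n k ≡ moment n 0 k
A1≡moment n k = count (Av321 n)
  where
  count : ∀ l → length (filter (λ σ → des σ ≟ k) l) ≡ sum (map (momentWeight 0 k ∘ stat) l)
  count []      = refl
  count (σ ∷ l) with des σ ≡ᵇ k
  ... | true  = cong suc (count l)
  ... | false = count l

moment-recurrence-0 : ∀ n i → 1 ≤ n → moment (suc n) i 0 ≡ moment n i 0 + momentPred n i 0
moment-recurrence-0 n i 1≤n = begin
    moment (suc n) i 0
  ≡⟨ total-suc n (momentWeight i 0) 1≤n ⟩
    total n (insertionsWeight (momentWeight i 0))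
  ≡⟨ total-cong n (insertionsWeight (momentWeight i 0)) (λ p → momentWeight i 0 p + momentWeightPred i 0 p) 1≤n (weight-recurrence-0 i) ⟩
    total n (λ p → momentWeight i 0 p + momentWeightPred i 0 p)
  ≡⟨ total-+ n (momentWeight i 0) (momentWeightPred i 0) ⟩
    moment n i 0 + total n (momentWeightPred i 0)
  ≡⟨ cong (moment n i 0 +_) (total-momentWeightPred n i 0) ⟩
    moment n i 0 + momentPred n i 0
  ∎
  where open ≡-Reasoning

-- Only the identity has no descent: M_n(i, 0) = C(n, i).
moment-no-descent : ∀ n i → 1 ≤ n → moment n i 0 ≡ binom n i
moment-no-descent (suc zero)    i _ = +-identityʳ (binom 1 i)
moment-no-descent (suc (suc n)) i _ =
  trans (moment-recurrence-0 (suc n) i (s≤s z≤n))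
        (trans (cong₂ _+_ (moment-no-descent (suc n) i (s≤s z≤n)) (pred-moment i)) (sym (pascal (suc n) i)))
  where
  pred-moment : ∀ i → momentPred (suc n) i 0 ≡ binomPred (suc n) i
  pred-moment zero    = refl
  pred-moment (suc j) = moment-no-descent (suc n) j (s≤s z≤n)

moment-recurrence-S : ∀ n i D → 1 ≤ n →
  moment (suc n) i (suc D) + ifZero i (moment n 0 D) ≡
  2 * moment n i (suc D) + momentPred n i (suc D) + ifZero D (moment n i 0) + moment n (suc i) D
moment-recurrence-S n i D 1≤n = begin
    moment (suc n) i (suc D) + ifZero i (moment n 0 D)
  ≡⟨ cong₂ _+_ (total-suc n (momentWeight i (suc D)) 1≤n) (sym (total-ifZero n i (momentWeight 0 D))) ⟩
    total n (insertionsWeight (momentWeight i (suc D))) + total n (λ p → ifZero i (momentWeight 0 D p))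
  ≡⟨ total-+ n (insertionsWeight (momentWeight i (suc D))) (λ p → ifZero i (momentWeight 0 D p)) ⟨
    total n (λ p → insertionsWeight (momentWeight i (suc D)) p + ifZero i (momentWeight 0 D p))
  ≡⟨ total-cong n (λ p → insertionsWeight (momentWeight i (suc D)) p + ifZero i (momentWeight 0 D p)) (λ p → a p + b p + c p + e p) 1≤n (λ d r → recurrenceS i D d r) ⟩
    total n (λ p → a p + b p + c p + e p)
  ≡⟨ total-+ n (λ p → a p + b p + c p) e ⟩
    total n (λ p → a p + b p + c p) + moment n (suc i) D
  ≡⟨ cong (_+ moment n (suc i) D) (total-+ n (λ p → a p + b p) c) ⟩
    total n (λ p → a p + b p) + total n c + moment n (suc i) D
  ≡⟨ cong (λ t → t + total n c + moment n (suc i) D) (total-+ n a b) ⟩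
    total n a + total n b + total n c + moment n (suc i) D
  ≡⟨ cong (λ t → t + moment n (suc i) D)
       (cong₂ _+_ (cong₂ _+_ (total-* n 2 (momentWeight i (suc D))) (total-momentWeightPred n i (suc D)))
                  (total-ifZero n D (momentWeight i 0))) ⟩
    2 * moment n i (suc D) + momentPred n i (suc D) + ifZero D (moment n i 0) + moment n (suc i) D
  ∎
  where
  open ≡-Reasoning
  a b c e : ℕ × ℕ → ℕ
  a p = 2 * momentWeight i (suc D) p
  b   = momentWeightPred i (suc D)
  c p = ifZero D (momentWeight i 0 p)
  e   = momentWeight (suc i) D

moment-parity-recurrence : ∀ n i D → 1 ≤ n →
  parity (moment (suc n) i (suc D)) ≡
  parity (ifZero i (moment n 0 D)) ⊕ (parity (momentPred n i (suc D)) ⊕ parity (ifZero D (moment n i 0)) ⊕ parity (moment n (suc i) D))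
moment-parity-recurrence n i D 1≤n = move-left (begin
    parity (moment (suc n) i (suc D)) ⊕ parity (ifZero i (moment n 0 D))
  ≡⟨ +-homo-+ (moment (suc n) i (suc D)) (ifZero i (moment n 0 D)) ⟨
    parity (moment (suc n) i (suc D) + ifZero i (moment n 0 D))
  ≡⟨ cong parity (moment-recurrence-S n i D 1≤n) ⟩
    parity (2 * x + y + z + w)
  ≡⟨ +-homo-+ (2 * x + y + z) w ⟩
    parity (2 * x + y + z) ⊕ parity w
  ≡⟨ cong (_⊕ parity w) (+-homo-+ (2 * x + y) z) ⟩
    parity (2 * x + y) ⊕ parity z ⊕ parity w
  ≡⟨ cong (λ t → t ⊕ parity z ⊕ parity w) (+-homo-+ (2 * x) y) ⟩
    parity (2 * x) ⊕ parity y ⊕ parity z ⊕ parity w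
  ≡⟨ cong (λ t → t ⊕ parity y ⊕ parity z ⊕ parity w) (*-homo-* 2 x) ⟩
    parity y ⊕ parity z ⊕ parity w
  ∎)
  where
  open ≡-Reasoning
  x y z w : ℕ
  x = moment n i (suc D)
  y = momentPred n i (suc D)
  z = ifZero D (moment n i 0)
  w = moment n (suc i) D
  move-left : ∀ {a b c} → a ⊕ b ≡ c → a ≡ b ⊕ c
  move-left {0ℙ} {0ℙ} refl = refl
  move-left {0ℙ} {1ℙ} refl = refl
  move-left {1ℙ} {0ℙ} refl = refl
  move-left {1ℙ} {1ℙ} refl = refl

when≤ : ℕ → ℕ → Parity → Parity
when≤ a b x = if does (a ≤? b) then x else 0ℙ

when≤-yes : ∀ {a b} x → a ≤ b → when≤ a b x ≡ x
when≤-yes {a} {b} x a≤b = cong (λ t → if t then x else 0ℙ) (dec-true (a ≤? b) a≤b)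

when≤-no : ∀ {a b} x → ¬ a ≤ b → when≤ a b x ≡ 0ℙ
when≤-no {a} {b} x a≰b = cong (λ t → if t then x else 0ℙ) (dec-false (a ≤? b) a≰b)

-- The parity of M_{N-1}(i, D+1): that of C(N, i+D+1) when i + 2(D+1) ≤ N, even otherwise.
predictedParity : ℕ → ℕ → ℕ → Parity
predictedParity N i D = when≤ (i + suc D + suc D) N (parity (binom N (i + suc D)))

-- The guard is redundant for C(N, Y+1) with threshold Y+1, since C(N, Y+1) = 0 for N ≤ Y.
when≤-binom : ∀ N Y → when≤ (suc Y) N (parity (binom N (suc Y))) ≡ parity (binom N (suc Y))
when≤-binom N Y with suc Y ≤? N
... | yes Y<N = when≤-yes _ Y<N
... | no  Y≮N = trans (when≤-no _ Y≮N) (cong parity (sym (binom-above N (suc Y) (≰⇒> Y≮N))))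

when≤-pascal : ∀ n X Y →
  when≤ X (suc n) (parity (binom (suc n) Y)) ⊕ when≤ X (suc n) (parity (binom (suc n) (suc Y))) ≡
  when≤ (suc X) (suc (suc n)) (parity (binom (suc (suc n)) (suc Y)))
when≤-pascal n X Y with X ≤? suc n
... | yes X≤n+1 = trans (cong₂ _⊕_ (when≤-yes _ X≤n+1) (when≤-yes _ X≤n+1))
  (sym (trans (when≤-yes _ (s≤s X≤n+1)) (+-homo-+ (binom (suc n) Y) (binom (suc n) (suc Y)))))
... | no  X≰n+1 = trans (cong₂ _⊕_ (when≤-no _ X≰n+1) (when≤-no _ X≰n+1)) (sym (when≤-no _ (X≰n+1 ∘ ≤-pred)))

-- Pascal's rule for thresholds 2Y and 2Y+1; when 2Y = n+1 the first term is the
-- central binomial coefficient C(2Y, Y), which is even.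
when≤-pascal-central : ∀ n b → let Y = suc b in
  when≤ (Y + Y) (suc n) (parity (binom (suc n) Y)) ⊕ when≤ (suc (Y + Y)) (suc n) (parity (binom (suc n) (suc Y))) ≡
  when≤ (suc (suc (Y + Y))) (suc (suc n)) (parity (binom (suc (suc n)) (suc Y)))
when≤-pascal-central n b with suc (suc b + suc b) ≤? suc n
... | yes 2Y+1≤n+1 =
  trans (cong₂ _⊕_ (when≤-yes _ (≤-trans (n≤1+n _) 2Y+1≤n+1)) (when≤-yes _ 2Y+1≤n+1))
        (sym (trans (when≤-yes _ (s≤s 2Y+1≤n+1)) (+-homo-+ (binom (suc n) (suc b)) (binom (suc n) (suc (suc b))))))
... | no  2Y+1≰n+1 =
  trans (cong₂ _⊕_ first (when≤-no _ 2Y+1≰n+1)) (sym (when≤-no _ (2Y+1≰n+1 ∘ ≤-pred)))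
  where
  Y : ℕ
  Y = suc b
  first : when≤ (Y + Y) (suc n) (parity (binom (suc n) Y)) ≡ 0ℙ
  first with Y + Y ≤? suc n
  ... | no  2Y≰n+1 = when≤-no _ 2Y≰n+1
  ... | yes 2Y≤n+1 = trans (when≤-yes _ 2Y≤n+1)
    (subst (λ m → parity (binom m Y) ≡ 0ℙ) (≤-antisym 2Y≤n+1 (≮⇒≥ 2Y+1≰n+1)) (central-binom-even b))

-- For n = 1 all thresholds exceed 2 except for i = D = 0, where C(2, 1) is even.
predictedParity-2 : ∀ i D → predictedParity 2 i D ≡ 0ℙ
predictedParity-2 zero    zero    = refl
predictedParity-2 zero    (suc D) = when≤-no _ (<⇒≱ (+-mono-≤ (s≤s (s≤s (z≤n {D}))) (s≤s (z≤n {suc D}))))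
predictedParity-2 (suc j) D = when≤-no _ (<⇒≱ (s≤s (+-mono-≤ (≤-trans (s≤s z≤n) (m≤n+m (suc D) j)) (s≤s (z≤n {D})))))

moment-parity-step : ∀ n → 1 ≤ n → (∀ i D → parity (moment n i (suc D)) ≡ predictedParity (suc n) i D) →
  ∀ i D → parity (moment (suc n) i (suc D)) ≡ predictedParity (suc (suc n)) i D
moment-parity-step n 1≤n IH i D = trans (moment-parity-recurrence n i D 1≤n) (cases i D)
  where
  no-descent : ∀ i → moment n i 0 ≡ binom n i
  no-descent i = moment-no-descent n i 1≤n

  cases : ∀ i D →
    parity (ifZero i (moment n 0 D)) ⊕ (parity (momentPred n i (suc D)) ⊕ parity (ifZero D (moment n i 0)) ⊕ parity (moment n (suc i) D))
      ≡ predictedParity (suc (suc n)) i D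
  cases zero zero
    rewrite no-descent 0 | no-descent 1 = sym (⊕-assoc 1ℙ 1ℙ (parity (binom n 1)))
  cases (suc j) zero
    rewrite IH j 0 | no-descent (suc j) | no-descent (suc (suc j)) = begin
      predictedParity (suc n) j 0 ⊕ parity (binom n (suc j)) ⊕ parity (binom n (suc (suc j)))
    ≡⟨ ⊕-assoc (predictedParity (suc n) j 0) _ _ ⟩
      predictedParity (suc n) j 0 ⊕ (parity (binom n (suc j)) ⊕ parity (binom n (suc (suc j))))
    ≡⟨ cong₂ _⊕_ (no-descents-threshold (suc n) j)
                 (sym (trans (when≤-binom (suc n) (suc j)) (+-homo-+ (binom n (suc j)) (binom n (suc (suc j)))))) ⟩
      when≤ (suc (suc j)) (suc n) (parity (binom (suc n) (suc j))) ⊕ when≤ (suc (suc j)) (suc n) (parity (binom (suc n) (suc (suc j))))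
    ≡⟨ when≤-pascal n (suc (suc j)) (suc j) ⟩
      when≤ (suc (suc (suc j))) (suc (suc n)) (parity (binom (suc (suc n)) (suc (suc j))))
    ≡⟨ no-descents-threshold (suc (suc n)) (suc j) ⟨
      predictedParity (suc (suc n)) (suc j) 0
    ∎
    where
    open ≡-Reasoning
    no-descents-threshold : ∀ N j → predictedParity N j 0 ≡ when≤ (suc (suc j)) N (parity (binom N (suc j)))
    no-descents-threshold N j =
      cong₂ (λ a b → when≤ a N (parity (binom N b))) (trans (+-assoc j 1 1) (+-comm j 2)) (+-comm j 1)
  cases zero (suc D)
    rewrite IH 0 D | IH 1 D =
    trans (when≤-pascal-central n D)
          (cong (λ a → when≤ a (suc (suc n)) (parity (binom (suc (suc n)) (suc (suc D))))) (cong suc (sym (+-suc (suc D) (suc D)))))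
  cases (suc j) (suc D)
    rewrite IH j (suc D) | IH (suc (suc j)) D | ⊕-identityʳ (predictedParity (suc n) j (suc D)) =
    trans (cong (predictedParity (suc n) j (suc D) ⊕_)
                (cong₂ (λ a b → when≤ a (suc n) (parity (binom (suc n) b))) threshold index))
          (when≤-pascal n (j + suc (suc D) + suc (suc D)) (j + suc (suc D)))
    where
    threshold : suc (suc j) + suc D + suc D ≡ j + suc (suc D) + suc (suc D)
    threshold = sym (trans (cong (_+ suc (suc D)) (+-suc j (suc D))) (cong suc (+-suc (j + suc D) (suc D))))
    index : suc (suc j) + suc D ≡ suc (j + suc (suc D))
    index = cong suc (sym (+-suc j (suc D)))

moment-parity : ∀ n → 1 ≤ n → ∀ i D → parity (moment n i (suc D)) ≡ predictedParity (suc n) i D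
moment-parity (suc zero)    _ i D = sym (predictedParity-2 i D)
moment-parity (suc (suc n)) _ = moment-parity-step (suc n) (s≤s z≤n) (moment-parity (suc n) (s≤s z≤n))

-- At N = 2^m the predicted parity of M_{N-1}(0, D+1) is even, since C(2^m, D+1) is
-- even whenever 2(D+1) ≤ 2^m.
predictedParity-pow2 : ∀ m D → predictedParity (2 ^ m) 0 D ≡ 0ℙ
predictedParity-pow2 m D with suc D + suc D ≤? 2 ^ m
... | yes 2D+2≤2^m = trans (when≤-yes _ 2D+2≤2^m)
  (binom-pow2-even m (suc D) (s≤s z≤n) (<-≤-trans (m<m+n (suc D) (s≤s z≤n)) 2D+2≤2^m))
... | no  2D+2≰2^m = when≤-no _ 2D+2≰2^m

theorem7p5 : (m n : ℕ) → n ≡ 2 ^ m ∸ 1 →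
    (A1 n 0 ≡ 1) × (∀ k → k ≥ 1 → ∃[ j ] A1 n k ≡ 2 * j)
theorem7p5 zero    .0 refl = refl , λ { (suc k) _ → 0 , refl }
theorem7p5 (suc m) n n≡2^m-1 = no-descent , even
  where
  n+1≡2^m : suc n ≡ 2 ^ suc m
  n+1≡2^m = trans (cong suc n≡2^m-1) (trans (+-comm 1 (2 ^ suc m ∸ 1)) (m∸n+n≡m (m^n>0 2 (suc m))))

  1≤n : 1 ≤ n
  1≤n = ≤-pred (subst (2 ≤_) (sym n+1≡2^m) (*-monoʳ-≤ 2 (m^n>0 2 m)))

  no-descent : A1 n 0 ≡ 1
  no-descent = trans (A1≡moment n 0) (moment-no-descent n 0 1≤n)

  even : ∀ k → k ≥ 1 → ∃[ j ] A1 n k ≡ 2 * j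
  even (suc D) _ = parity-even (A1 n (suc D)) (begin
      parity (A1 n (suc D))         ≡⟨ cong parity (A1≡moment n (suc D)) ⟩
      parity (moment n 0 (suc D))   ≡⟨ moment-parity n 1≤n 0 D ⟩
      predictedParity (suc n) 0 D   ≡⟨ cong (λ N → predictedParity N 0 D) n+1≡2^m ⟩
      predictedParity (2 ^ suc m) 0 D ≡⟨ predictedParity-pow2 (suc m) D ⟩
      0ℙ                            ∎)
    where open ≡-Reasoning
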